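{- Consider $n$ parallel servers, each of capacity $C$, and an online sequence of job sets $J(1),\dots,J(T)$ in which every job $j$ has weight $w(j)\in[0,\epsilon]$. Let $\mathrm{ALG}=\sum_i W(A_i)$ be the total weight assigned by PARALLELLOADBALANCE (defined in the context) and $\mathrm{OPT}$ the maximum total weight of a feasible assignment for the instance. Then $\mathrm{ALG}\ge (1-2\epsilon/C)\,\mathrm{OPT}$, i.e. PARALLELLOADBALANCE is $\frac{1}{1-2\epsilon/C}$-competitive.
   Context: Parallel servers: all servers have the same capacity $C$ and each job $j$ consumes the same quantity $w(j)$ of resources on every server. At each time step $t$ a set $J(t)$ of jobs arrives; a feasible assignment assigns, at each time step, each server at most one job and each job to at most one server, such that the total weight assigned to each server over all time is at most $C$; assignments must be made online and irrevocably. For a set of jobs $A$, $W(A)=\sum_{j\in A}w(j)$. An algorithm is $\gamma$-competitive if on every instance its total weight is at least $1/\gamma$ times the optimal feasible weight. PARALLELLOADBALANCE: initially $A_i=\emptyset$ for all servers $i$. For $t=1,\dots,T$: process the jobs $j\in J(t)$ in non-increasing order of weight; for each such job, let $i$ be a server with the highest remaining capacity $C-W(A_i)$ among servers not yet assigned a job in the current time step; if $W(A_i\cup\{j\})\le C$ set $A_i\leftarrow A_i\cup\{j\}$; otherwise the algorithm terminates (no further jobs are ever assigned).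
   Formalization: The job weights $w(j)$, the capacity $C$ and the parameter $\epsilon$ are rational numbers. -}

module Defs where

open import Data.Nat as ℕ using (ℕ; zero; suc)
open import Data.Fin as Fin using (Fin; zero; suc)
open import Data.Bool using (Bool; true; false; if_then_else_)
open import Data.Maybe using (Maybe; just; nothing)
open import Data.List using (List; []; _∷_; length; lookup)
open import Data.List.Relation.Unary.All using (All; []; _∷_)
open import Data.List.Relation.Binary.Permutation.Propositional using (_↭_)
open import Data.List.Relation.Unary.Linked using (Linked)
open import Data.Rational using (ℚ; 0ℚ; 1ℚ; _+_; _-_; _*_; _÷_; _≤_; _<_; >-nonZero)
open import Relation.Binary.PropositionalEquality using (_≡_)
open import Relation.Nullary using (¬_; does)

ΣFin : (n : ℕ) → (Fin n → ℚ) → ℚ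
ΣFin zero    f = 0ℚ
ΣFin (suc n) f = f zero + ΣFin n (λ k → f (suc k))

-- An instance is a list of time steps; time step t is the list J(t)
-- of the weights of the jobs arriving at t (jobs = list positions).

Instance : Set
Instance = List (List ℚ)

-- Feasible (offline) assignments.
-- At one time step with job list J, each job is sent to at most one
-- server (Maybe), and each server receives at most one job (injectivity).

record StepAssignment (n : ℕ) (J : List ℚ) : Set where
  field
    σ   : Fin (length J) → Maybe (Fin n)
    inj : ∀ a b (i : Fin n) → σ a ≡ just i → σ b ≡ just i → a ≡ b
open StepAssignment public

Assignment : ℕ → Instance → Set
Assignment n Js = All (StepAssignment n) Js

isAt : ∀ {n} → Maybe (Fin n) → Fin n → Bool
isAt nothing  i = false
isAt (just k) i = does (k Fin.≟ i)

isSome : ∀ {n} → Maybe (Fin n) → Bool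
isSome nothing  = false
isSome (just _) = true

stepLoad : ∀ {n J} → StepAssignment n J → Fin n → ℚ
stepLoad {n} {J} s i =
  ΣFin (length J) (λ a → if isAt (σ s a) i then lookup J a else 0ℚ)

stepValue : ∀ {n J} → StepAssignment n J → ℚ
stepValue {n} {J} s =
  ΣFin (length J) (λ a → if isSome (σ s a) then lookup J a else 0ℚ)

load : ∀ {n Js} → Assignment n Js → Fin n → ℚ
load []       i = 0ℚ
load (s ∷ ss) i = stepLoad s i + load ss i

value : ∀ {n Js} → Assignment n Js → ℚ
value []       = 0ℚ
value (s ∷ ss) = stepValue s + value ss

Feasible : ∀ {n Js} → ℚ → Assignment n Js → Set
Feasible {n} C A = ∀ (i : Fin n) → load A i ≤ C

-- PARALLELLOADBALANCE, as a relation describing all its executions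
-- (any tie-breaking among servers of maximal remaining capacity and
-- among jobs of equal weight is allowed).

Loads : ℕ → Set
Loads n = Fin n → ℚ

Used : ℕ → Set
Used n = Fin n → Bool

update : ∀ {A : Set} {n} → (Fin n → A) → Fin n → A → (Fin n → A)
update f i v k = if does (k Fin.≟ i) then v else f k

data Outcome (n : ℕ) : Set where
  running : Loads n → Outcome n
  halted  : Loads n → Outcome n

IsBest : ∀ {n} → ℚ → Loads n → Used n → Fin n → Set
IsBest {n} C L U i = U i ≡ false × (∀ (k : Fin n) → U k ≡ false → C - L k ≤ C - L i)
  where open import Data.Product using (_×_)

data StepRun {n : ℕ} (C : ℚ) : Loads n → Used n → List ℚ → Outcome n → Set where
  done     : ∀ {L U} → StepRun C L U [] (running L)
  noServer : ∀ {L U w ws o} → (∀ (k : Fin n) → U k ≡ true) →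
             StepRun C L U ws o → StepRun C L U (w ∷ ws) o
  assign   : ∀ {L U w ws o} (i : Fin n) → IsBest C L U i → L i + w ≤ C →
             StepRun C (update L i (L i + w)) (update U i true) ws o →
             StepRun C L U (w ∷ ws) o
  halt     : ∀ {L U w ws} (i : Fin n) → IsBest C L U i → ¬ (L i + w ≤ C) →
             StepRun C L U (w ∷ ws) (halted L)

NonIncreasingOrder : List ℚ → List ℚ → Set
NonIncreasingOrder J ord = ord ↭ J × Linked (λ a b → b ≤ a) ord
  where open import Data.Product using (_×_)

data Run {n : ℕ} (C : ℚ) : Loads n → Instance → Loads n → Set where
  end  : ∀ {L} → Run C L [] L
  step : ∀ {L L' F J Js} (ord : List ℚ) → NonIncreasingOrder J ord →
         StepRun C L (λ _ → false) ord (running L') →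
         Run C L' Js F → Run C L (J ∷ Js) F
  stop : ∀ {L L' J Js} (ord : List ℚ) → NonIncreasingOrder J ord →
         StepRun C L (λ _ → false) ord (halted L') →
         Run C L (J ∷ Js) L'

total : ∀ {n} → Loads n → ℚ
total {n} L = ΣFin n L

factor : (C ε : ℚ) → 0ℚ < C → ℚ
factor C ε hC = 1ℚ - ((1ℚ + 1ℚ) * ε) ÷ C
  where instance _ = >-nonZero hC

WeightsIn : ℚ → Instance → Set
WeightsIn ε Js = All (All (λ w → 0ℚ ≤ w × w ≤ ε)) Js
  where open import Data.Product using (_×_)

module Submission where

-- Fix a time step and a threshold τ ≥ 0. A server takes at most one job per step, so any
-- assignment earns at most nτ + Σⱼ (wⱼ − τ)⁺ in that step. When the algorithm completes a step,
-- the jobs come in non-increasing order and go to distinct servers until none is free, so for the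
-- right τ it earns at least this much; hence if it never halts, ALG ≥ OPT. Moreover the loads
-- never differ by more than ε, because each job goes to a least loaded free server and weighs
-- at most the jobs placed before it in the step. So when a job of weight ≤ ε does not fit, every
-- server already carries more than C − 2ε, and ALG ≥ n(C − 2ε) ≥ (1 − 2ε/C)·OPT since OPT ≤ nC.

open import Defs
open import Data.Bool using (Bool; true; false; if_then_else_)
open import Data.Bool.Properties using (if-eta; if-float)
open import Data.Empty using (⊥-elim)
open import Data.Fin as Fin using (Fin; zero; suc)
open import Data.Fin.Properties using (suc-injective)
open import Data.List using (List; []; _∷_; length; lookup; map; foldr)
open import Data.List.Membership.Propositional.Properties using (∈-lookup)
open import Data.List.Relation.Binary.Permutation.Propositional using (_↭_; ↭-sym; ↭⇒↭ₛ)
open import Data.List.Relation.Binary.Permutation.Propositional.Properties using (map⁺; All-resp-↭)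
import Data.List.Relation.Binary.Permutation.Setoid.Properties as ↭ₛ
open import Data.List.Relation.Unary.All as All using (All; []; _∷_)
open import Data.List.Relation.Unary.Linked as Linked using (Linked; [-]; _∷_)
open import Data.List.Relation.Unary.Linked.Properties using (Linked⇒All)
open import Data.Maybe using (Maybe; just; nothing)
open import Data.Nat using (ℕ; zero; suc)
open import Data.Product using (Σ-syntax; _×_; _,_; proj₁; proj₂)
open import Data.Rational
  using (ℚ; 0ℚ; 1ℚ; _+_; _-_; -_; _*_; _⊔_; 1/_; _≤_; _<_; _≤?_; positive; nonNegative; nonPositive; >-nonZero)
import Data.Rational.Properties as ℚ
open import Data.Rational.Solver using (module +-*-Solver)
open import Data.Sum as ⊎ using (_⊎_; inj₁; inj₂)
open import Relation.Binary.PropositionalEquality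
open import Relation.Nullary using (¬_; does; yes; no)

open import Algebra.Properties.CommutativeMonoid.Sum ℚ.+-0-commutativeMonoid
  using (sum; sum-replicate-zero; ∑-distrib-+)
open import Algebra.Properties.Group ℚ.+-0-group using () renaming (∙-cancelʳ to +-cancelʳ)
open +-*-Solver

private
  variable
    n : ℕ

p≤p+q : ∀ p {q} → 0ℚ ≤ q → p ≤ p + q
p≤p+q p 0≤q = subst (_≤ p + _) (ℚ.+-identityʳ p) (ℚ.+-monoʳ-≤ p 0≤q)

p-q≤p : ∀ p {q} → 0ℚ ≤ q → p - q ≤ p
p-q≤p p 0≤q = subst (p - _ ≤_) (ℚ.+-identityʳ p) (ℚ.+-monoʳ-≤ p (ℚ.neg-antimono-≤ 0≤q))

p-q≤p-r⇒r≤q : ∀ p {q r} → p - q ≤ p - r → r ≤ q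
p-q≤p-r⇒r≤q p {q} {r} h = begin
  r                       ≡⟨ solve 3 (λ p q r → r := (p :- q) :+ (q :+ r :- p)) refl p q r ⟩
  (p - q) + (q + r - p)   ≤⟨ ℚ.+-monoˡ-≤ (q + r - p) h ⟩
  (p - r) + (q + r - p)   ≡⟨ solve 3 (λ p q r → (p :- r) :+ (q :+ r :- p) := q) refl p q r ⟩
  q                       ∎
  where open ℚ.≤-Reasoning

-- Finite sums

ΣFin≡sum : ∀ n (f : Fin n → ℚ) → ΣFin n f ≡ sum f
ΣFin≡sum zero    f = refl
ΣFin≡sum (suc n) f = cong (f zero +_) (ΣFin≡sum n (λ k → f (suc k)))

ΣFin-cong : ∀ n {f g : Fin n → ℚ} → (∀ k → f k ≡ g k) → ΣFin n f ≡ ΣFin n g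
ΣFin-cong zero    f≗g = refl
ΣFin-cong (suc n) f≗g = cong₂ _+_ (f≗g zero) (ΣFin-cong n (λ k → f≗g (suc k)))

ΣFin-mono-≤ : ∀ n {f g : Fin n → ℚ} → (∀ k → f k ≤ g k) → ΣFin n f ≤ ΣFin n g
ΣFin-mono-≤ zero    f≤g = ℚ.≤-refl
ΣFin-mono-≤ (suc n) f≤g = ℚ.+-mono-≤ (f≤g zero) (ΣFin-mono-≤ n (λ k → f≤g (suc k)))

ΣFin-zero : ∀ n → ΣFin n (λ _ → 0ℚ) ≡ 0ℚ
ΣFin-zero n = trans (ΣFin≡sum n _) (sum-replicate-zero n)

ΣFin-nonNeg : ∀ n {f : Fin n → ℚ} → (∀ k → 0ℚ ≤ f k) → 0ℚ ≤ ΣFin n f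
ΣFin-nonNeg n {f} 0≤f = subst (_≤ ΣFin n f) (ΣFin-zero n) (ΣFin-mono-≤ n 0≤f)

ΣFin-distrib-+ : ∀ n (f g : Fin n → ℚ) → ΣFin n (λ k → f k + g k) ≡ ΣFin n f + ΣFin n g
ΣFin-distrib-+ n f g
  rewrite ΣFin≡sum n (λ k → f k + g k) | ΣFin≡sum n f | ΣFin≡sum n g = ∑-distrib-+ f g

ΣFin-comm : ∀ m n (F : Fin m → Fin n → ℚ) →
  ΣFin m (λ i → ΣFin n (F i)) ≡ ΣFin n (λ j → ΣFin m (λ i → F i j))
ΣFin-comm zero    n F = sym (ΣFin-zero n)
ΣFin-comm (suc m) n F = trans (cong (ΣFin n (F zero) +_) (ΣFin-comm m n (λ i → F (suc i))))
                              (sym (ΣFin-distrib-+ n (F zero) _))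

*-distribˡ-ΣFin : ∀ n c (f : Fin n → ℚ) → c * ΣFin n f ≡ ΣFin n (λ k → c * f k)
*-distribˡ-ΣFin zero    c f = ℚ.*-zeroʳ c
*-distribˡ-ΣFin (suc n) c f =
  trans (ℚ.*-distribˡ-+ c (f zero) _) (cong (c * f zero +_) (*-distribˡ-ΣFin n c _))

ΣFin-update : ∀ n (f : Fin n → ℚ) i v → ΣFin n (update f i v) + f i ≡ ΣFin n f + v
ΣFin-update (suc n) f zero    v =
  solve 3 (λ v s f₀ → (v :+ s) :+ f₀ := (f₀ :+ s) :+ v) refl v (ΣFin n (λ k → f (suc k))) (f zero)
ΣFin-update (suc n) f (suc i) v = begin
  (f zero + ΣFin n (update f′ i v)) + f′ i  ≡⟨ ℚ.+-assoc (f zero) _ _ ⟩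
  f zero + (ΣFin n (update f′ i v) + f′ i)  ≡⟨ cong (f zero +_) (ΣFin-update n f′ i v) ⟩
  f zero + (ΣFin n f′ + v)                  ≡⟨ ℚ.+-assoc (f zero) _ _ ⟨
  (f zero + ΣFin n f′) + v                  ∎
  where
  open ≡-Reasoning
  f′ : Fin n → ℚ
  f′ k = f (suc k)

ΣFin-indicator : ∀ n (k : Fin n) c → ΣFin n (λ i → if does (k Fin.≟ i) then c else 0ℚ) ≡ c
ΣFin-indicator (suc n) zero    c = trans (cong (c +_) (ΣFin-zero n)) (ℚ.+-identityʳ c)
ΣFin-indicator (suc n) (suc k) c = trans (cong (0ℚ +_) (ΣFin-indicator n k c)) (ℚ.+-identityˡ c)

ΣFin-if-false : ∀ n {b : Fin n → Bool} {h : Fin n → ℚ} → (∀ k → b k ≡ false) →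
  ΣFin n (λ k → if b k then h k else 0ℚ) ≡ 0ℚ
ΣFin-if-false n b≡false = trans (ΣFin-cong n (λ k → cong (if_then _ else 0ℚ) (b≡false k))) (ΣFin-zero n)

listSum : List ℚ → ℚ
listSum = foldr _+_ 0ℚ

ΣFin-lookup : ∀ (f : ℚ → ℚ) xs → ΣFin (length xs) (λ a → f (lookup xs a)) ≡ listSum (map f xs)
ΣFin-lookup f []       = refl
ΣFin-lookup f (x ∷ xs) = cong (f x +_) (ΣFin-lookup f xs)

listSum-↭ : ∀ (f : ℚ → ℚ) {xs ys} → xs ↭ ys → listSum (map f xs) ≡ listSum (map f ys)
listSum-↭ f xs↭ys =
  ↭ₛ.foldr-commMonoid (setoid ℚ) ℚ.+-0-isCommutativeMonoid (↭⇒↭ₛ (map⁺ f xs↭ys))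

listSum-mono-≤ : ∀ {f g : ℚ → ℚ} xs → (∀ x → f x ≤ g x) → listSum (map f xs) ≤ listSum (map g xs)
listSum-mono-≤ []       f≤g = ℚ.≤-refl
listSum-mono-≤ (x ∷ xs) f≤g = ℚ.+-mono-≤ (f≤g x) (listSum-mono-≤ xs f≤g)

excess : ℚ → ℚ → ℚ
excess τ w = (w - τ) ⊔ 0ℚ

excess-nonNeg : ∀ τ w → 0ℚ ≤ excess τ w
excess-nonNeg τ w = ℚ.p≤q⊔p (w - τ) 0ℚ

≤-+-excess : ∀ τ w → w ≤ τ + excess τ w
≤-+-excess τ w = begin
  w                   ≡⟨ solve 2 (λ w τ → w := τ :+ (w :- τ)) refl w τ ⟩
  τ + (w - τ)         ≤⟨ ℚ.+-monoʳ-≤ τ (ℚ.p≤p⊔q (w - τ) 0ℚ) ⟩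
  τ + excess τ w      ∎
  where open ℚ.≤-Reasoning

excess-antitone : ∀ {τ τ′} → τ′ ≤ τ → ∀ w → excess τ w ≤ excess τ′ w
excess-antitone τ′≤τ w = ℚ.⊔-monoˡ-≤ 0ℚ (ℚ.+-monoʳ-≤ w (ℚ.neg-antimono-≤ τ′≤τ))

excess-self : ∀ w → excess w w ≡ 0ℚ
excess-self w = trans (cong (_⊔ 0ℚ) (ℚ.+-inverseʳ w)) (ℚ.⊔-idem 0ℚ)

excess-≥ : ∀ {τ w} → τ ≤ w → excess τ w ≡ w - τ
excess-≥ {τ} {w} τ≤w = ℚ.p≥q⇒p⊔q≡p (begin
  0ℚ     ≡⟨ ℚ.+-inverseʳ τ ⟨
  τ - τ  ≤⟨ ℚ.+-monoˡ-≤ (- τ) τ≤w ⟩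
  w - τ  ∎)
  where open ℚ.≤-Reasoning

-- One time step: the optimum

isAt≡true⇒≡just : ∀ (x : Maybe (Fin n)) i → isAt x i ≡ true → x ≡ just i
isAt≡true⇒≡just (just k) i isAt≡true with k Fin.≟ i
... | yes k≡i = cong just k≡i

ΣFin-isAt : ∀ n (x : Maybe (Fin n)) c →
  ΣFin n (λ i → if isAt x i then c else 0ℚ) ≡ (if isSome x then c else 0ℚ)
ΣFin-isAt n nothing  c = ΣFin-zero n
ΣFin-isAt n (just k) c = ΣFin-indicator n k c

ΣFin-isAt-comm : ∀ n m (σ : Fin m → Maybe (Fin n)) (h : Fin m → ℚ) →
  ΣFin n (λ i → ΣFin m (λ a → if isAt (σ a) i then h a else 0ℚ)) ≡
  ΣFin m (λ a → if isSome (σ a) then h a else 0ℚ)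
ΣFin-isAt-comm n m σ h =
  trans (ΣFin-comm n m _) (ΣFin-cong m (λ a → ΣFin-isAt n (σ a) (h a)))

stepValue≡ΣstepLoad : ∀ {J} (s : StepAssignment n J) → stepValue s ≡ ΣFin n (stepLoad s)
stepValue≡ΣstepLoad {n} {J} s = sym (ΣFin-isAt-comm n (length J) (σ s) (lookup J))

value≡Σload : ∀ {Js} (A : Assignment n Js) → value A ≡ ΣFin n (load A)
value≡Σload {n} []      = sym (ΣFin-zero n)
value≡Σload {n} (s ∷ A) =
  trans (cong₂ _+_ (stepValue≡ΣstepLoad s) (value≡Σload A)) (sym (ΣFin-distrib-+ n (stepLoad s) (load A)))

ΣFin-atMostOne-≤ : ∀ m (P : Fin m → Bool) {w g : Fin m → ℚ} {τ} → 0ℚ ≤ τ →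
  (∀ a → w a ≤ τ + g a) → (∀ a b → P a ≡ true → P b ≡ true → a ≡ b) →
  ΣFin m (λ a → if P a then w a else 0ℚ) ≤ τ + ΣFin m (λ a → if P a then g a else 0ℚ)
ΣFin-atMostOne-≤ zero P {τ = τ} 0≤τ w≤ unique = subst (0ℚ ≤_) (sym (ℚ.+-identityʳ τ)) 0≤τ
ΣFin-atMostOne-≤ (suc m) P {w} {g} {τ} 0≤τ w≤ unique with P zero in P₀
... | true = begin
  w zero + rest w     ≡⟨ cong (w zero +_) (ΣFin-if-false m others) ⟩
  w zero + 0ℚ         ≡⟨ ℚ.+-identityʳ (w zero) ⟩
  w zero              ≤⟨ w≤ zero ⟩
  τ + g zero          ≡⟨ cong (τ +_) (ℚ.+-identityʳ (g zero)) ⟨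
  τ + (g zero + 0ℚ)   ≡⟨ cong (λ z → τ + (g zero + z)) (ΣFin-if-false m others) ⟨
  τ + (g zero + rest g) ∎
  where
  open ℚ.≤-Reasoning
  rest : (Fin (suc m) → ℚ) → ℚ
  rest h = ΣFin m (λ a → if P (suc a) then h (suc a) else 0ℚ)
  others : ∀ a → P (suc a) ≡ false
  others a with P (suc a) in Pₐ
  ... | false = refl
  ... | true with () ← unique zero (suc a) P₀ Pₐ
... | false = begin
  0ℚ + rest w         ≡⟨ ℚ.+-identityˡ (rest w) ⟩
  rest w              ≤⟨ ΣFin-atMostOne-≤ m (λ a → P (suc a)) 0≤τ (λ a → w≤ (suc a))
                           (λ a b p q → suc-injective (unique (suc a) (suc b) p q)) ⟩
  τ + rest g          ≡⟨ cong (τ +_) (ℚ.+-identityˡ (rest g)) ⟨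
  τ + (0ℚ + rest g)   ∎
  where
  open ℚ.≤-Reasoning
  rest : (Fin (suc m) → ℚ) → ℚ
  rest h = ΣFin m (λ a → if P (suc a) then h (suc a) else 0ℚ)

if-≤ : ∀ b {x} → 0ℚ ≤ x → (if b then x else 0ℚ) ≤ x
if-≤ true  0≤x = ℚ.≤-refl
if-≤ false 0≤x = 0≤x

stepLoad-≤ : ∀ {J} (s : StepAssignment n J) i {τ} → 0ℚ ≤ τ →
  stepLoad s i ≤ τ + ΣFin (length J) (λ a → if isAt (σ s a) i then excess τ (lookup J a) else 0ℚ)
stepLoad-≤ {J = J} s i {τ} 0≤τ =
  ΣFin-atMostOne-≤ (length J) (λ a → isAt (σ s a) i) 0≤τ (λ a → ≤-+-excess τ (lookup J a))
    (λ a b p q → inj s a b i (isAt≡true⇒≡just _ i p) (isAt≡true⇒≡just _ i q))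

stepValue-≤ : ∀ {J} (s : StepAssignment n J) {τ} → 0ℚ ≤ τ →
  stepValue s ≤ ΣFin n (λ _ → τ) + listSum (map (excess τ) J)
stepValue-≤ {n} {J} s {τ} 0≤τ = begin
  stepValue s                                       ≡⟨ stepValue≡ΣstepLoad s ⟩
  ΣFin n (stepLoad s)                               ≤⟨ ΣFin-mono-≤ n (λ i → stepLoad-≤ s i 0≤τ) ⟩
  ΣFin n (λ i → τ + ΣFin m (excessAt i))            ≡⟨ ΣFin-distrib-+ n _ _ ⟩
  nτ + ΣFin n (λ i → ΣFin m (excessAt i))           ≡⟨ cong (nτ +_) (ΣFin-isAt-comm n m (σ s) e) ⟩
  nτ + ΣFin m (λ a → if isSome (σ s a) then e a else 0ℚ)
                                                    ≤⟨ ℚ.+-monoʳ-≤ nτ (ΣFin-mono-≤ m (λ a →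
                                                         if-≤ (isSome (σ s a)) (excess-nonNeg τ (lookup J a)))) ⟩
  nτ + ΣFin m e                                     ≡⟨ cong (nτ +_) (ΣFin-lookup (excess τ) J) ⟩
  nτ + listSum (map (excess τ) J)                   ∎
  where
  open ℚ.≤-Reasoning
  m  = length J
  nτ = ΣFin n (λ _ → τ)
  e : Fin m → ℚ
  e a = excess τ (lookup J a)
  excessAt : Fin n → Fin m → ℚ
  excessAt i a = if isAt (σ s a) i then e a else 0ℚ

-- One time step: the algorithm

NonIncreasing : List ℚ → Set
NonIncreasing = Linked (λ a b → b ≤ a)

NonIncreasing⇒≤-head : ∀ {w ws} → NonIncreasing (w ∷ ws) → All (_≤ w) ws
NonIncreasing⇒≤-head [-]            = []
NonIncreasing⇒≤-head (x≤w ∷ sorted) = Linked⇒All (λ b≤a c≤b → ℚ.≤-trans c≤b b≤a) x≤w sorted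

perFreeServer : Used n → ℚ → ℚ
perFreeServer {n} U τ = ΣFin n (λ k → if U k then 0ℚ else τ)

perFreeServer-use : ∀ (U : Used n) i τ → U i ≡ false →
  perFreeServer (update U i true) τ + τ ≡ perFreeServer U τ
perFreeServer-use {n} U i τ Ui≡false = begin
  perFreeServer (update U i true) τ + τ  ≡⟨ cong₂ _+_ (ΣFin-cong n (λ k → if-float h′ (does (k Fin.≟ i))))
                                                      (cong h′ (sym Ui≡false)) ⟩
  ΣFin n (update h i 0ℚ) + h i           ≡⟨ ΣFin-update n h i 0ℚ ⟩
  ΣFin n h + 0ℚ                          ≡⟨ ℚ.+-identityʳ _ ⟩
  perFreeServer U τ                      ∎
  where
  open ≡-Reasoning
  h′ : Bool → ℚ
  h′ b = if b then 0ℚ else τ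
  h : Fin n → ℚ
  h k = h′ (U k)

perFreeServer-zero : ∀ (U : Used n) → perFreeServer U 0ℚ ≡ 0ℚ
perFreeServer-zero {n} U = trans (ΣFin-cong n (λ k → if-eta (U k))) (ΣFin-zero n)

perFreeServer-allUsed : ∀ (U : Used n) {τ} → (∀ k → U k ≡ true) → perFreeServer U τ ≡ 0ℚ
perFreeServer-allUsed {n} U {τ} allUsed =
  trans (ΣFin-cong n (λ k → cong (if_then 0ℚ else τ) (allUsed k))) (ΣFin-zero n)

total-update : ∀ (L : Loads n) i w → total (update L i (L i + w)) ≡ total L + w
total-update {n} L i w = +-cancelʳ (L i) _ _ (trans (ΣFin-update n L i (L i + w))
  (solve 3 (λ t a w → t :+ (a :+ w) := (t :+ w) :+ a) refl (total L) (L i) w))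

All-ordered : ∀ {P : ℚ → Set} {J ord} → NonIncreasingOrder J ord → All P J → All P ord
All-ordered (ord↭J , _) = All-resp-↭ (↭-sym ord↭J)

loadsOf : Outcome n → Loads n
loadsOf (running L) = L
loadsOf (halted L)  = L

update-grows : ∀ (L : Loads n) i {w} → 0ℚ ≤ w → ∀ k → L k ≤ update L i (L i + w) k
update-grows L i 0≤w k with k Fin.≟ i
... | yes refl = p≤p+q (L k) 0≤w
... | no  _    = ℚ.≤-refl

module _ {C : ℚ} where

  -- τ is the weight of the first job left over for lack of a free server, or 0 if there is none.
  StepRun-gain : ∀ {L U ord L′ m} → 0ℚ ≤ m → All (_≤ m) ord → All (0ℚ ≤_) ord → NonIncreasing ord →
    StepRun {n} C L U ord (running L′) →
    Σ[ τ ∈ ℚ ] (0ℚ ≤ τ × τ ≤ m × perFreeServer U τ + listSum (map (excess τ) ord) + total L ≤ total L′)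
  StepRun-gain {L = L} {U} 0≤m _ _ _ done = 0ℚ , ℚ.≤-refl , 0≤m , ℚ.≤-reflexive (begin
    perFreeServer U 0ℚ + 0ℚ + total L  ≡⟨ cong (λ z → z + 0ℚ + total L) (perFreeServer-zero U) ⟩
    0ℚ + 0ℚ + total L                  ≡⟨ cong (_+ total L) (ℚ.+-identityˡ 0ℚ) ⟩
    0ℚ + total L                       ≡⟨ ℚ.+-identityˡ (total L) ⟩
    total L                            ∎)
    where open ≡-Reasoning
  StepRun-gain {L = L} {U} {w ∷ ws} {L′} _ (w≤m ∷ _) (0≤w ∷ 0≤ws) sorted (noServer allUsed sr)
    with StepRun-gain 0≤w (NonIncreasing⇒≤-head sorted) 0≤ws (Linked.tail sorted) sr
  ... | τ , _ , τ≤w , gain = w , 0≤w , w≤m , (begin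
    perFreeServer U w + (excess w w + S w) + total L  ≡⟨ cong₂ (λ a b → a + (b + S w) + total L)
                                                                (perFreeServer-allUsed U allUsed) (excess-self w) ⟩
    0ℚ + (0ℚ + S w) + total L                          ≡⟨ cong (_+ total L) (ℚ.+-identityˡ (0ℚ + S w)) ⟩
    0ℚ + S w + total L                                 ≡⟨ cong (λ z → z + S w + total L)
                                                                (perFreeServer-allUsed U allUsed) ⟨
    perFreeServer U τ + S w + total L                  ≤⟨ ℚ.+-monoˡ-≤ (total L)
                                                           (ℚ.+-monoʳ-≤ (perFreeServer U τ)
                                                             (listSum-mono-≤ ws (excess-antitone τ≤w))) ⟩
    perFreeServer U τ + S τ + total L                  ≤⟨ gain ⟩
    total L′                                           ∎)
    where
    open ℚ.≤-Reasoning
    S : ℚ → ℚ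
    S x = listSum (map (excess x) ws)
  StepRun-gain {L = L} {U} {w ∷ ws} {L′} _ (w≤m ∷ _) (0≤w ∷ 0≤ws) sorted (assign i (Ui≡false , _) _ sr)
    with StepRun-gain 0≤w (NonIncreasing⇒≤-head sorted) 0≤ws (Linked.tail sorted) sr
  ... | τ , 0≤τ , τ≤w , gain = τ , 0≤τ , ℚ.≤-trans τ≤w w≤m , (begin
    perFreeServer U τ + (excess τ w + S) + total L   ≡⟨ cong₂ (λ a b → a + (b + S) + total L)
                                                               (sym (perFreeServer-use U i τ Ui≡false)) (excess-≥ τ≤w) ⟩
    (F′ + τ) + ((w - τ) + S) + total L              ≡⟨ solve 5 (λ f t w s l → (f :+ t) :+ ((w :- t) :+ s) :+ l
                                                                := f :+ s :+ (l :+ w)) refl F′ τ w S (total L) ⟩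
    F′ + S + (total L + w)                           ≡⟨ cong (F′ + S +_) (total-update L i w) ⟨
    F′ + S + total (update L i (L i + w))            ≤⟨ gain ⟩
    total L′                                         ∎)
    where
    open ℚ.≤-Reasoning
    S  = listSum (map (excess τ) ws)
    F′ = perFreeServer (update U i true) τ

  StepRun-gain≥stepValue : ∀ {ε L L′ J ord} → 0ℚ ≤ ε → All (λ w → 0ℚ ≤ w × w ≤ ε) J →
    NonIncreasingOrder J ord → StepRun {n} C L (λ _ → false) ord (running L′) →
    (s : StepAssignment n J) → stepValue s + total L ≤ total L′
  StepRun-gain≥stepValue {n} {L = L} {L′} {J} {ord} 0≤ε inRange order@(ord↭J , sorted) sr s
    with StepRun-gain 0≤ε (All.map proj₂ (All-ordered order inRange))
                          (All.map proj₁ (All-ordered order inRange)) sorted sr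
  ... | τ , 0≤τ , _ , gain = begin
    stepValue s + total L                                    ≤⟨ ℚ.+-monoˡ-≤ (total L) (stepValue-≤ s 0≤τ) ⟩
    ΣFin n (λ _ → τ) + listSum (map (excess τ) J) + total L  ≡⟨ cong (λ z → ΣFin n (λ _ → τ) + z + total L)
                                                                      (listSum-↭ (excess τ) ord↭J) ⟨
    ΣFin n (λ _ → τ) + listSum (map (excess τ) ord) + total L ≤⟨ gain ⟩
    total L′                                                 ∎
    where open ℚ.≤-Reasoning

  StepRun-loads-grow : ∀ {L U ord o} → All (0ℚ ≤_) ord → StepRun {n} C L U ord o → ∀ k → L k ≤ loadsOf o k
  StepRun-loads-grow _           done                  k = ℚ.≤-refl
  StepRun-loads-grow (_ ∷ 0≤ws)  (noServer _ sr)       k = StepRun-loads-grow 0≤ws sr k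
  StepRun-loads-grow _           (halt _ _ _)          k = ℚ.≤-refl
  StepRun-loads-grow {L = L} (0≤w ∷ 0≤ws) (assign i _ _ sr) k =
    ℚ.≤-trans (update-grows L i 0≤w k) (StepRun-loads-grow 0≤ws sr k)

  Run-loads-grow : ∀ {ε L Js F} → WeightsIn ε Js → Run {n} C L Js F → ∀ k → L k ≤ F k
  Run-loads-grow _ end k = ℚ.≤-refl
  Run-loads-grow (inRange ∷ inRanges) (step _ order sr run) k = ℚ.≤-trans
    (StepRun-loads-grow (All.map proj₁ (All-ordered order inRange)) sr k) (Run-loads-grow inRanges run k)
  Run-loads-grow (inRange ∷ _) (stop _ order sr) k =
    StepRun-loads-grow (All.map proj₁ (All-ordered order inRange)) sr k

  Run-total-nonNeg : ∀ {ε Js F} → WeightsIn ε Js → Run {n} C (λ _ → 0ℚ) Js F → 0ℚ ≤ total F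
  Run-total-nonNeg {n} inRanges run = ΣFin-nonNeg n (Run-loads-grow inRanges run)

-- Balanced loads

module _ (C ε : ℚ) where

  Balanced : Loads n → Set
  Balanced L = ∀ j k → L j ≤ L k + ε

  Full : Loads n → Set
  Full L = ∀ k → C - (ε + ε) ≤ L k

  BalancedOrFull : Outcome n → Set
  BalancedOrFull (running L) = Balanced L
  BalancedOrFull (halted L)  = Full L

  -- L₀ are the loads at the start of the time step; m bounds the weights still to come and is
  -- at most every weight assigned so far in the step.
  record StepInvariant (L₀ : Loads n) (m : ℚ) (L : Loads n) (U : Used n) : Set where
    field
      balanced : Balanced L
      unused   : ∀ k → U k ≡ false → L k ≡ L₀ k
      raised   : ∀ k → U k ≡ true → L₀ k + m ≤ L k

  StepInvariant-lower : ∀ {L₀ m m′ L U} → m′ ≤ m → StepInvariant {n} L₀ m L U → StepInvariant L₀ m′ L U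
  StepInvariant-lower {L₀ = L₀} m′≤m inv = record
    { balanced = balanced
    ; unused   = unused
    ; raised   = λ k Uk → ℚ.≤-trans (ℚ.+-monoʳ-≤ (L₀ k) m′≤m) (raised k Uk)
    }
    where open StepInvariant inv

  stepStart : ∀ {L : Loads n} → Balanced L → StepInvariant L ε L (λ _ → false)
  stepStart bal = record { balanced = bal ; unused = λ _ _ → refl ; raised = λ _ () }

  overflow⇒Full : ∀ {L : Loads n} {w} i → Balanced L → w ≤ ε → ¬ (L i + w ≤ C) → Full L
  overflow⇒Full {L = L} {w} i bal w≤ε overflow k = begin
    C - (ε + ε)              ≤⟨ ℚ.+-monoˡ-≤ (- (ε + ε)) C≤ ⟩
    L k + (ε + ε) - (ε + ε)  ≡⟨ solve 2 (λ l e → l :+ (e :+ e) :- (e :+ e) := l) refl (L k) ε ⟩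
    L k                      ∎
    where
    open ℚ.≤-Reasoning
    C≤ : C ≤ L k + (ε + ε)
    C≤ = begin
      C              <⟨ ℚ.≰⇒> overflow ⟩
      L i + w        ≤⟨ ℚ.+-mono-≤ (bal i k) w≤ε ⟩
      L k + ε + ε    ≡⟨ ℚ.+-assoc (L k) ε ε ⟩
      L k + (ε + ε)  ∎

  assign-preserves : ∀ {L₀ L : Loads n} {U m w} i → Balanced L₀ → IsBest C L U i →
    0ℚ ≤ w → w ≤ ε → w ≤ m → StepInvariant L₀ m L U →
    StepInvariant L₀ w (update L i (L i + w)) (update U i true)
  assign-preserves {L₀ = L₀} {L} {U} {m} {w} i bal₀ (Ui≡false , best) 0≤w w≤ε w≤m inv = record
    { balanced = balanced′ ; unused = unused′ ; raised = raised′ }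
    where
    open StepInvariant inv
    Li≡L₀i : L i ≡ L₀ i
    Li≡L₀i = unused i Ui≡false
    new≤ : ∀ k → L i + w ≤ L k + ε
    new≤ k with U k in Uk
    ... | false = ℚ.+-mono-≤ (p-q≤p-r⇒r≤q C (best k Uk)) w≤ε
    ... | true  = begin
      L i + w          ≤⟨ ℚ.+-mono-≤ (subst (_≤ L₀ k + ε) (sym Li≡L₀i) (bal₀ i k)) w≤m ⟩
      L₀ k + ε + m     ≡⟨ solve 3 (λ a e m → a :+ e :+ m := a :+ m :+ e) refl (L₀ k) ε m ⟩
      L₀ k + m + ε     ≤⟨ ℚ.+-monoˡ-≤ ε (raised k Uk) ⟩
      L k + ε          ∎
      where open ℚ.≤-Reasoning
    balanced′ : Balanced (update L i (L i + w))
    balanced′ j k with j Fin.≟ i | k Fin.≟ i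
    ... | yes refl | yes refl = p≤p+q (L i + w) (ℚ.≤-trans 0≤w w≤ε)
    ... | yes refl | no  _    = new≤ k
    ... | no  _    | yes refl = ℚ.≤-trans (balanced j i) (ℚ.+-monoˡ-≤ ε (p≤p+q (L i) 0≤w))
    ... | no  _    | no  _    = balanced j k
    unused′ : ∀ k → update U i true k ≡ false → update L i (L i + w) k ≡ L₀ k
    unused′ k Uk with k Fin.≟ i
    ... | no _ = unused k Uk
    raised′ : ∀ k → update U i true k ≡ true → L₀ k + w ≤ update L i (L i + w) k
    raised′ k Uk with k Fin.≟ i
    ... | yes refl = ℚ.≤-reflexive (cong (_+ w) (sym Li≡L₀i))
    ... | no  _    = StepInvariant.raised (StepInvariant-lower w≤m inv) k Uk

  StepRun-balancedOrFull : ∀ {L₀ L U ord o m} → Balanced L₀ → All (λ w → 0ℚ ≤ w × w ≤ ε) ord →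
    All (_≤ m) ord → NonIncreasing ord → StepInvariant L₀ m L U → StepRun {n} C L U ord o → BalancedOrFull o
  StepRun-balancedOrFull _ _ _ _ inv done = StepInvariant.balanced inv
  StepRun-balancedOrFull bal₀ (_ ∷ inRange) (w≤m ∷ _) sorted inv (noServer _ sr) =
    StepRun-balancedOrFull bal₀ inRange (NonIncreasing⇒≤-head sorted) (Linked.tail sorted)
      (StepInvariant-lower w≤m inv) sr
  StepRun-balancedOrFull _ ((_ , w≤ε) ∷ _) _ _ inv (halt i _ overflow) =
    overflow⇒Full i (StepInvariant.balanced inv) w≤ε overflow
  StepRun-balancedOrFull bal₀ ((0≤w , w≤ε) ∷ inRange) (w≤m ∷ _) sorted inv (assign i best _ sr) =
    StepRun-balancedOrFull bal₀ inRange (NonIncreasing⇒≤-head sorted) (Linked.tail sorted)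
      (assign-preserves i bal₀ best 0≤w w≤ε w≤m inv) sr

  Run-bound : ∀ {L Js F} → 0ℚ ≤ ε → Balanced L → WeightsIn ε Js → Run {n} C L Js F →
    (A : Assignment n Js) → value A + total L ≤ total F ⊎ Full F
  Run-bound {L = L} _ _ [] end [] = inj₁ (ℚ.≤-reflexive (ℚ.+-identityˡ (total L)))
  Run-bound {L = L} 0≤ε bal (inRange ∷ inRanges) (step {L' = L′} ord order@(_ , sorted) sr run) (s ∷ A)
    with Run-bound 0≤ε (StepRun-balancedOrFull bal inRange′ (All.map proj₂ inRange′) sorted (stepStart bal) sr)
                   inRanges run A
    where
    inRange′ : All (λ w → 0ℚ ≤ w × w ≤ ε) ord
    inRange′ = All-ordered order inRange
  ... | inj₂ full = inj₂ full
  ... | inj₁ rest = inj₁ (begin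
    stepValue s + value A + total L    ≡⟨ solve 3 (λ s a l → s :+ a :+ l := a :+ (s :+ l))
                                                    refl (stepValue s) (value A) (total L) ⟩
    value A + (stepValue s + total L)  ≤⟨ ℚ.+-monoʳ-≤ (value A) (StepRun-gain≥stepValue 0≤ε inRange order sr s) ⟩
    value A + total L′                 ≤⟨ rest ⟩
    _                                  ∎)
    where open ℚ.≤-Reasoning
  Run-bound 0≤ε bal (inRange ∷ _) (stop ord order@(_ , sorted) sr) _ =
    inj₂ (StepRun-balancedOrFull bal inRange′ (All.map proj₂ inRange′) sorted (stepStart bal) sr)
    where
    inRange′ : All (λ w → 0ℚ ≤ w × w ≤ ε) ord
    inRange′ = All-ordered order inRange

stepValue-nonNeg : ∀ {J} (s : StepAssignment n J) → All (0ℚ ≤_) J → 0ℚ ≤ stepValue s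
stepValue-nonNeg {J = J} s 0≤J =
  ΣFin-nonNeg (length J) (λ a → if-nonNeg (isSome (σ s a)) (All.lookup 0≤J (∈-lookup a)))
  where
  if-nonNeg : ∀ b {x} → 0ℚ ≤ x → 0ℚ ≤ (if b then x else 0ℚ)
  if-nonNeg true  0≤x = 0≤x
  if-nonNeg false 0≤x = ℚ.≤-refl

value-nonNeg : ∀ {ε Js} → WeightsIn ε Js → (A : Assignment n Js) → 0ℚ ≤ value A
value-nonNeg []                   []      = ℚ.≤-refl
value-nonNeg (inRange ∷ inRanges) (s ∷ A) =
  subst (_≤ stepValue s + value A) (ℚ.+-identityˡ 0ℚ)
    (ℚ.+-mono-≤ (stepValue-nonNeg s (All.map proj₁ inRange)) (value-nonNeg inRanges A))

value≡0 : ∀ {ε Js} → ¬ (0ℚ ≤ ε) → WeightsIn ε Js → (A : Assignment n Js) → value A ≡ 0ℚ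
value≡0 ε≱0 []                      []      = refl
value≡0 ε≱0 ([] ∷ inRanges)         (_ ∷ A) = trans (cong (0ℚ +_) (value≡0 ε≱0 inRanges A)) (ℚ.+-identityˡ 0ℚ)
value≡0 ε≱0 (((0≤w , w≤ε) ∷ _) ∷ _) _       = ⊥-elim (ε≱0 (ℚ.≤-trans 0≤w w≤ε))

-- The competitive ratio

factor-*-C : ∀ C ε (0<C : 0ℚ < C) → factor C ε 0<C * C ≡ C - (ε + ε)
factor-*-C C ε 0<C = begin
  (1ℚ - (1ℚ + 1ℚ) * ε * 1/ C) * C  ≡⟨ solve 3 (λ ε u c → (con 1ℚ :- (con 1ℚ :+ con 1ℚ) :* ε :* u) :* c
                                                     := c :- (ε :+ ε) :* (u :* c)) refl ε (1/ C) C ⟩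
  C - (ε + ε) * (1/ C * C)         ≡⟨ cong (λ x → C - (ε + ε) * x) (ℚ.*-inverseˡ C) ⟩
  C - (ε + ε) * 1ℚ                 ≡⟨ cong (λ x → C - x) (ℚ.*-identityʳ (ε + ε)) ⟩
  C - (ε + ε)                      ∎
  where
  open ≡-Reasoning
  instance _ = >-nonZero 0<C

factor≤1 : ∀ {C ε} (0<C : 0ℚ < C) → 0ℚ ≤ ε → factor C ε 0<C ≤ 1ℚ
factor≤1 {C} {ε} 0<C 0≤ε = ℚ.*-cancelʳ-≤-pos C {{positive 0<C}} (begin
  factor C ε 0<C * C  ≡⟨ factor-*-C C ε 0<C ⟩
  C - (ε + ε)         ≤⟨ p-q≤p C (ℚ.+-mono-≤ 0≤ε 0≤ε) ⟩
  C                   ≡⟨ ℚ.*-identityˡ C ⟨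
  1ℚ * C              ∎)
  where open ℚ.≤-Reasoning

factor-*-≤ : ∀ n {C ε v T} (0<C : 0ℚ < C) → 0ℚ ≤ v → 0ℚ ≤ T → v ≤ ΣFin n (λ _ → C) →
  (0ℚ ≤ ε × v ≤ T) ⊎ ΣFin n (λ _ → C - (ε + ε)) ≤ T → factor C ε 0<C * v ≤ T
factor-*-≤ n {C} {ε} {v} {T} 0<C 0≤v 0≤T v≤nC (inj₁ (0≤ε , v≤T)) = begin
  factor C ε 0<C * v  ≤⟨ ℚ.*-monoʳ-≤-nonNeg v {{nonNegative 0≤v}} (factor≤1 0<C 0≤ε) ⟩
  1ℚ * v              ≡⟨ ℚ.*-identityˡ v ⟩
  v                   ≤⟨ v≤T ⟩
  T                   ∎
  where open ℚ.≤-Reasoning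
factor-*-≤ n {C} {ε} {v} {T} 0<C 0≤v 0≤T v≤nC (inj₂ n[C-2ε]≤T) with 0ℚ ≤? factor C ε 0<C
... | yes 0≤factor = begin
  factor C ε 0<C * v                  ≤⟨ ℚ.*-monoˡ-≤-nonNeg (factor C ε 0<C) {{nonNegative 0≤factor}} v≤nC ⟩
  factor C ε 0<C * ΣFin n (λ _ → C)   ≡⟨ *-distribˡ-ΣFin n (factor C ε 0<C) (λ _ → C) ⟩
  ΣFin n (λ _ → factor C ε 0<C * C)   ≡⟨ ΣFin-cong n (λ _ → factor-*-C C ε 0<C) ⟩
  ΣFin n (λ _ → C - (ε + ε))          ≤⟨ n[C-2ε]≤T ⟩
  T                                   ∎
  where open ℚ.≤-Reasoning
... | no factor≱0 = begin
  factor C ε 0<C * v   ≤⟨ ℚ.*-monoˡ-≤-nonPos (factor C ε 0<C) {{nonPositive (ℚ.<⇒≤ (ℚ.≰⇒> factor≱0))}} 0≤v ⟩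
  factor C ε 0<C * 0ℚ  ≡⟨ ℚ.*-zeroʳ (factor C ε 0<C) ⟩
  0ℚ                   ≤⟨ 0≤T ⟩
  T                    ∎
  where open ℚ.≤-Reasoning

theorem3 : (n : ℕ) (C ε : ℚ) (hC : 0ℚ < C) (Js : Instance) →
    WeightsIn ε Js →
    (F : Loads n) → Run C (λ _ → 0ℚ) Js F →
    (A : Assignment n Js) → Feasible C A →
    factor C ε hC * value A ≤ total F
theorem3 n C ε 0<C Js inRanges F run A feasible with 0ℚ ≤? ε
... | no ε≱0 = begin
  factor C ε 0<C * value A  ≡⟨ cong (factor C ε 0<C *_) (value≡0 ε≱0 inRanges A) ⟩
  factor C ε 0<C * 0ℚ       ≡⟨ ℚ.*-zeroʳ (factor C ε 0<C) ⟩
  0ℚ                        ≤⟨ Run-total-nonNeg inRanges run ⟩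
  total F                   ∎
  where open ℚ.≤-Reasoning
... | yes 0≤ε = factor-*-≤ n 0<C (value-nonNeg inRanges A) (Run-total-nonNeg inRanges run) value≤nC
                  (⊎.map (λ gain → 0≤ε , subst (_≤ total F) value+0≡value gain) (ΣFin-mono-≤ n)
                    (Run-bound C ε 0≤ε balanced₀ inRanges run A))
  where
  value≤nC : value A ≤ ΣFin n (λ _ → C)
  value≤nC = subst (_≤ ΣFin n (λ _ → C)) (sym (value≡Σload A)) (ΣFin-mono-≤ n feasible)
  value+0≡value : value A + total {n} (λ _ → 0ℚ) ≡ value A
  value+0≡value = trans (cong (value A +_) (ΣFin-zero n)) (ℚ.+-identityʳ (value A))
  balanced₀ : Balanced C ε {n} (λ _ → 0ℚ)
  balanced₀ _ _ = subst (0ℚ ≤_) (sym (ℚ.+-identityˡ ε)) 0≤ε
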